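{- For every CABA $\mathcal{B}$, the order relation $\sqsubseteq\ : \mathcal{B}\to\!\!\!\!\!\mapsto\mathcal{B}$ is directionally atomic, and it is the identity for composition of directionally atomic relations: for every directionally atomic $R : \mathcal{B}\to\!\!\!\!\!\mapsto\mathcal{B}'$ we have $(\sqsubseteq_{\mathcal{B}});R = R = R;(\sqsubseteq_{\mathcal{B}'})$.
   Context: Relations are subsets of products; composition is in diagrammatic order: $a\mathrel{(R;S)}c$ iff there is $b$ with $a\mathrel{R}b$ and $b\mathrel{S}c$. An atom of a poset with bottom $\bot$ is $a\neq\bot$ with $x\sqsubseteq a\Rightarrow x\in\{\bot,a\}$; a CABA is a complete Boolean algebra in which every element is the join of the atoms below it. A relation $R : \mathcal{B}\to\!\!\!\!\!\mapsto\mathcal{B}'$ between CABAs is: a bimodule if $p'\sqsubseteq p\mathrel{R}q\sqsubseteq q'$ implies $p'\mathrel{R}q'$; left-disjunctive if for any family $(a_i)_{i\in I}$, $a_i\mathrel{R}b$ for all $i$ implies $(\bigsqcup_i a_i)\mathrel{R}b$; atomic-founded if whenever $a$ is an atom of $\mathcal{B}$ and $a\mathrel{R}b$ there is an atom $b'\sqsubseteq b$ of $\mathcal{B}'$ with $a\mathrel{R}b'$; directionally atomic if all three hold. -}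

module Defs where

open import Level using (Level; _⊔_) renaming (suc to lsuc)
open import Algebra.Lattice.Bundles using (BooleanAlgebra)
open import Data.Product using (Σ; ∃; ∃-syntax; _×_; _,_; proj₁)
open import Data.Sum using (_⊎_)
open import Relation.Nullary renaming (¬_ to Not)
open import Relation.Binary.Core using (REL)

-- Joins exist for
-- all families indexed by types in Set (c ⊔ ℓ) (this includes every subset
-- of the carrier given by a predicate of level ≤ c ⊔ ℓ).
record CABA (c ℓ : Level) : Set (lsuc (c ⊔ ℓ)) where
  field
    booleanAlgebra : BooleanAlgebra c ℓ
  open BooleanAlgebra booleanAlgebra public

  infix 4 _⊑_
  _⊑_ : Carrier → Carrier → Set ℓ
  x ⊑ y = (x ∧ y) ≈ x

  IsAtom : Carrier → Set (c ⊔ ℓ)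
  IsAtom a = Not (a ≈ ⊥) × (∀ x → x ⊑ a → (x ≈ ⊥) ⊎ (x ≈ a))

  field
    ⨆       : {I : Set (c ⊔ ℓ)} → (I → Carrier) → Carrier
    ⨆-upper : {I : Set (c ⊔ ℓ)} (f : I → Carrier) (i : I) → f i ⊑ ⨆ f
    ⨆-least : {I : Set (c ⊔ ℓ)} (f : I → Carrier) (u : Carrier) →
              (∀ i → f i ⊑ u) → ⨆ f ⊑ u
    atomic  : ∀ x → x ≈ ⨆ {Σ Carrier (λ a → IsAtom a × a ⊑ x)} proj₁

open CABA

module _ {c ℓ c′ ℓ′ r : Level} (B : CABA c ℓ) (B′ : CABA c′ ℓ′) where

  private
    module B  = CABA B
    module B′ = CABA B′

  IsBimodule : REL (Carrier B) (Carrier B′) r → Set (c ⊔ ℓ ⊔ c′ ⊔ ℓ′ ⊔ r)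
  IsBimodule R = ∀ {p′ p q q′} → p′ B.⊑ p → R p q → q B′.⊑ q′ → R p′ q′

  IsLeftDisjunctive : REL (Carrier B) (Carrier B′) r → Set (lsuc (c ⊔ ℓ) ⊔ c′ ⊔ r)
  IsLeftDisjunctive R = ∀ {I : Set (c ⊔ ℓ)} (a : I → Carrier B) (b : Carrier B′) →
                        (∀ i → R (a i) b) → R (B.⨆ a) b

  IsAtomicFounded : REL (Carrier B) (Carrier B′) r → Set (c ⊔ ℓ ⊔ c′ ⊔ ℓ′ ⊔ r)
  IsAtomicFounded R = ∀ a b → B.IsAtom a → R a b →
                      ∃[ b′ ] (B′.IsAtom b′ × b′ B′.⊑ b × R a b′)

  record IsDirectionallyAtomic (R : REL (Carrier B) (Carrier B′) r)
         : Set (lsuc (c ⊔ ℓ) ⊔ c′ ⊔ ℓ′ ⊔ r) where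
    field
      bimodule         : IsBimodule R
      leftDisjunctive  : IsLeftDisjunctive R
      atomicFounded    : IsAtomicFounded R

infixr 9 _⨾_
_⨾_ : ∀ {a b c r s} {A : Set a} {B : Set b} {C : Set c} →
      REL A B r → REL B C s → REL A C (b ⊔ r ⊔ s)
(R ⨾ S) x z = ∃[ y ] (R x y × S y z)

{-# OPTIONS --safe #-}
module Submission where

open import Defs
open import Data.Product using (_×_; _,_)
open import Function.Bundles using (_⇔_; mk⇔)
open import Relation.Binary.Bundles using (Poset)
open import Relation.Binary.Core using (REL)
open import Relation.Binary.Definitions using (Reflexive; Transitive)
import Algebra.Lattice.Properties.Lattice as LatticeProperties

module _ {c ℓ} (B : CABA c ℓ) where
  open CABA B
  open Poset (LatticeProperties.poset lattice) using ()
    renaming (refl to ≤-refl; trans to ≤-trans)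

  -- The library's lattice order is x ≈ x ∧ y, the symmetric form of _⊑_.
  ⊑-refl : Reflexive _⊑_
  ⊑-refl = sym ≤-refl

  ⊑-trans : Transitive _⊑_
  ⊑-trans x⊑y y⊑z = sym (≤-trans (sym x⊑y) (sym y⊑z))

  ⊑-isDirectionallyAtomic : IsDirectionallyAtomic B B _⊑_
  ⊑-isDirectionallyAtomic = record
    { bimodule        = λ p′⊑p p⊑q q⊑q′ → ⊑-trans p′⊑p (⊑-trans p⊑q q⊑q′)
    ; leftDisjunctive = ⨆-least
    ; atomicFounded   = λ a b a-atom a⊑b → a , a-atom , a⊑b , ⊑-refl
    }

module _ {c ℓ c′ ℓ′ r} (B : CABA c ℓ) (B′ : CABA c′ ℓ′)
         {R : REL (CABA.Carrier B) (CABA.Carrier B′) r}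
         (R-bimodule : IsBimodule B B′ R) where

  ⊑-⨾-identityˡ : ∀ a b → (CABA._⊑_ B ⨾ R) a b ⇔ R a b
  ⊑-⨾-identityˡ a b = mk⇔
    (λ { (a′ , a⊑a′ , a′Rb) → R-bimodule a⊑a′ a′Rb (⊑-refl B′) })
    (λ aRb → a , ⊑-refl B , aRb)

  ⊑-⨾-identityʳ : ∀ a b → R a b ⇔ (R ⨾ CABA._⊑_ B′) a b
  ⊑-⨾-identityʳ a b = mk⇔
    (λ aRb → b , aRb , ⊑-refl B′)
    (λ { (b′ , aRb′ , b′⊑b) → R-bimodule (⊑-refl B) aRb′ b′⊑b })

mainTheorem8 : ∀ {c ℓ c′ ℓ′ r} (B : CABA c ℓ) →
    IsDirectionallyAtomic B B (CABA._⊑_ B)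
    × ((B′ : CABA c′ ℓ′) (R : REL (CABA.Carrier B) (CABA.Carrier B′) r) →
        IsDirectionallyAtomic B B′ R →
        (∀ a b → (CABA._⊑_ B ⨾ R) a b ⇔ R a b)
        × (∀ a b → R a b ⇔ (R ⨾ CABA._⊑_ B′) a b))
mainTheorem8 B = ⊑-isDirectionallyAtomic B , λ B′ R R-da →
  let open IsDirectionallyAtomic R-da using (bimodule) in
  ⊑-⨾-identityˡ B B′ bimodule , ⊑-⨾-identityʳ B B′ bimodule
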